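{- Let $s$ be a positive integer such that $2s+1$ is composite, and let $p$ be any prime divisor of $2s+1$. Then there exists a finite noncyclic abelian group of order $2s^2+2s-(p^2-1)/2$ having an $s$-spanning set of size $2$; in particular, the largest order of a finite noncyclic abelian group with an $s$-spanning set of size $2$ is at least $2s^2+2s-(p^2-1)/2$.
   Context: A subset $A$ of a finite abelian group $G$ (written additively) is an $s$-spanning set if every element of $G$ can be written as a signed sum of at most $s$ (not necessarily distinct) elements of $A$; for $A=\{a_1,a_2\}$ this means every element of $G$ equals $\lambda_1a_1+\lambda_2a_2$ for some integers with $|\lambda_1|+|\lambda_2|\le s$. -}

module Defs where

open import Level using (Level; _⊔_)
open import Data.Nat using (ℕ; zero; suc; _+_; _≤_)
open import Data.Integer using (ℤ; +_; -[1+_]; ∣_∣)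
open import Data.Fin using (Fin)
open import Data.Product using (Σ; ∃; _×_)
open import Relation.Binary.PropositionalEquality using (_≡_)
open import Relation.Nullary using (¬_)
open import Algebra.Bundles using (AbelianGroup)

module _ {c ℓ : Level} (G : AbelianGroup c ℓ) where
  open AbelianGroup G

  natMul : ℕ → Carrier → Carrier
  natMul zero    g = ε
  natMul (suc n) g = g ∙ natMul n g

  intMul : ℤ → Carrier → Carrier
  intMul (+ n)      g = natMul n g
  intMul -[1+ n ]   g = (natMul (suc n) g) ⁻¹

  HasOrder : ℕ → Set (c ⊔ ℓ)
  HasOrder n = Σ (Fin n → Carrier) λ f →
                 (∀ x → ∃ λ i → f i ≈ x) ×
                 (∀ i j → f i ≈ f j → i ≡ j)

  IsCyclic : Set (c ⊔ ℓ)
  IsCyclic = ∃ λ g → ∀ x → ∃ λ k → x ≈ intMul k g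

  -- {a₁, a₂} is an s-spanning set (of size 2, so a₁ ≉ a₂)
  SpanningPair : ℕ → Carrier → Carrier → Set (c ⊔ ℓ)
  SpanningPair s a₁ a₂ =
    ¬ (a₁ ≈ a₂) ×
    (∀ x → ∃ λ l₁ → ∃ λ l₂ →
       (∣ l₁ ∣ + ∣ l₂ ∣ ≤ s) × (x ≈ intMul l₁ a₁ ∙ intMul l₂ a₂))

  HasSpanningSetOfSize2 : ℕ → Set (c ⊔ ℓ)
  HasSpanningSetOfSize2 s = ∃ λ a₁ → ∃ λ a₂ → SpanningPair s a₁ a₂

module Submission where

-- Write 2s + 1 = p(2r + 1) with p = 2t + 1 and r ≥ 1 (as 2s + 1 is composite), and put
-- A = p(r + 1), B = pr, so that A + B = 2s + 1. Let G be ℤ² modulo the lattice spanned by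
-- (A, B) and (A, −B). The box [0, 2A) × [0, B) is a set of representatives, so |G| = 2AB,
-- which equals 2s² + 2s − (p² − 1)/2. The lattice lies in pℤ², so G maps onto (ℤ/p)² and is
-- not cyclic. Finally every box point is congruent to one of two vectors whose ℓ¹-lengths add
-- up to A + B = 2s + 1, so one of them is a signed combination of e₁, e₂ of length at most s.

open import Level using (0ℓ)
open import Data.Fin using (Fin; toℕ; fromℕ<; combine; remQuot)
import Data.Fin.Properties as Fin
open import Data.Product using (Σ; ∃; ∃₂; _×_; _,_; proj₁; proj₂; uncurry; map₁; map₂)
open import Data.Sum using (_⊎_; inj₁; inj₂)
open import Data.Empty using (⊥-elim)
open import Function using (_∘_)
open import Relation.Nullary using (¬_; yes; no)
open import Relation.Binary.PropositionalEquality
open import Algebra.Bundles using (AbelianGroup)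
open import Algebra.Structures using (IsAbelianGroup)
open import Defs
import Data.Nat as ℕ
import Data.Nat.Properties as ℕ
import Data.Nat.Divisibility as ℕ
import Data.Nat.DivMod as ℕ
import Data.Nat.Tactic.RingSolver as ℕ-Solver

module _ {c ℓ} (G : AbelianGroup c ℓ) where
  open AbelianGroup G using (Carrier; _≈_)

  hasOrder-× : ∀ {m n} (f : Fin m × Fin n → Carrier) →
               (∀ x → ∃ λ i → f i ≈ x) → (∀ i j → f i ≈ f j → i ≡ j) → HasOrder G (m ℕ.* n)
  hasOrder-× {m} {n} f surj inj = f ∘ remQuot {m} n , surj′ , inj′
    where
    surj′ : ∀ x → ∃ λ k → f (remQuot {m} n k) ≈ x
    surj′ x with (i , j) , fij≈x ← surj x =
      combine i j , subst (λ ij → f ij ≈ x) (sym (Fin.remQuot-combine i j)) fij≈x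
    inj′ : ∀ k l → f (remQuot {m} n k) ≈ f (remQuot {m} n l) → k ≡ l
    inj′ k l fk≈fl = begin
      k                                    ≡⟨ Fin.combine-remQuot {m} n k ⟨
      uncurry combine (remQuot {m} n k)   ≡⟨ cong (uncurry combine) (inj _ _ fk≈fl) ⟩
      uncurry combine (remQuot {m} n l)   ≡⟨ Fin.combine-remQuot {m} n l ⟩
      l                                    ∎
      where open ≡-Reasoning

module Lattices where
  open import Data.Nat using (ℕ; zero; suc; NonZero; NonTrivial; _<_; _≤_; _∸_)
  open import Data.Integer using (ℤ; +_; -[1+_]; _⊖_; -_; ∣_∣; 0ℤ; 1ℤ; _+_; _-_; _*_)
  import Data.Integer.Properties as ℤ
  open import Data.Integer.Divisibility.Signed using (_∣_; ∣ᵤ⇒∣; ∣⇒∣ᵤ; ∣m∣n⇒∣m+n; ∣m∣n⇒∣m-n; ∣n⇒∣m*n; ∣m⇒∣-m)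
  open import Data.Integer.DivMod using (_/ℕ_; _%ℕ_; n%ℕd<d; a≡a%ℕn+[a/ℕn]*n)
  open import Data.Integer.Tactic.RingSolver using (solve-∀)
  open import Algebra.Properties.CommutativeSemigroup ℕ.+-commutativeSemigroup
    using () renaming (interchange to +-interchange)

  ℤ² : Set
  ℤ² = ℤ × ℤ

  infixl 6 _+²_ _-²_
  infix 8 -²_
  infixr 7 _·²_

  _+²_ : ℤ² → ℤ² → ℤ²
  (a , b) +² (c , d) = a + c , b + d

  -²_ : ℤ² → ℤ²
  -² (a , b) = - a , - b

  _-²_ : ℤ² → ℤ² → ℤ²
  x -² y = x +² -² y

  _·²_ : ℤ → ℤ² → ℤ²
  k ·² (a , b) = k * a , k * b

  0² : ℤ²
  0² = 0ℤ , 0ℤ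

  e₁ e₂ : ℤ²
  e₁ = 1ℤ , 0ℤ
  e₂ = 0ℤ , 1ℤ

  -²-inverseʳ : ∀ x → x -² x ≡ 0²
  -²-inverseʳ (a , b) = cong₂ _,_ (ℤ.+-inverseʳ a) (ℤ.+-inverseʳ b)

  -²-telescope : ∀ x y z → (x -² y) +² (y -² z) ≡ x -² z
  -²-telescope (a , b) (c , d) (e , f) = cong₂ _,_ (ℤ.+-minus-telescope a c e) (ℤ.+-minus-telescope b d f)

  -²-swap : ∀ x y → -² (x -² y) ≡ y -² x
  -²-swap (a , b) (c , d) = cong₂ _,_ (swap a c) (swap b d)
    where
    swap : ∀ a c → - (a - c) ≡ c - a
    swap = solve-∀

  -²-interchange : ∀ x y u v → (x -² y) +² (u -² v) ≡ (x +² u) -² (y +² v)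
  -²-interchange (a , b) (c , d) (e , f) (g , h) = cong₂ _,_ (interchange a c e g) (interchange b d f h)
    where
    interchange : ∀ a c e g → (a - c) + (e - g) ≡ (a + e) - (c + g)
    interchange = solve-∀

  -²-distrib : ∀ x y → -² (x -² y) ≡ -² x -² -² y
  -²-distrib (a , b) (c , d) = cong₂ _,_ (distrib a c) (distrib b d)
    where
    distrib : ∀ a c → - (a - c) ≡ - a - - c
    distrib = solve-∀

  ℤ²-isAbelianGroup : IsAbelianGroup _≡_ _+²_ 0² (-²_)
  ℤ²-isAbelianGroup = record
    { isGroup = record
      { isMonoid = record
        { isSemigroup = record
          { isMagma = record { isEquivalence = isEquivalence ; ∙-cong = cong₂ _+²_ }
          ; assoc = λ { (a , b) (c , d) (e , f) → cong₂ _,_ (ℤ.+-assoc a c e) (ℤ.+-assoc b d f) } }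
        ; identity = (λ { (a , b) → cong₂ _,_ (ℤ.+-identityˡ a) (ℤ.+-identityˡ b) })
                   , (λ { (a , b) → cong₂ _,_ (ℤ.+-identityʳ a) (ℤ.+-identityʳ b) }) }
      ; inverse = (λ { (a , b) → cong₂ _,_ (ℤ.+-inverseˡ a) (ℤ.+-inverseˡ b) })
                , (λ { (a , b) → cong₂ _,_ (ℤ.+-inverseʳ a) (ℤ.+-inverseʳ b) })
      ; ⁻¹-cong = cong (-²_) }
    ; comm = λ { (a , b) (c , d) → cong₂ _,_ (ℤ.+-comm a c) (ℤ.+-comm b d) } }

  infix 4 _∣²_
  _∣²_ : ℤ → ℤ² → Set
  P ∣² (a , b) = (P ∣ a) × (P ∣ b)

  +m-+n≡k*o⇒k≡0 : ∀ {m n o} k → m < o → n < o → + m - + n ≡ k * + o → k ≡ 0ℤ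
  +m-+n≡k*o⇒k≡0 {m} {n} {o} k m<o n<o eq = ℤ.∣i∣≡0⇒i≡0 (ℕ.n<1⇒n≡0 (ℕ.*-cancelʳ-< o ∣ k ∣ 1 (begin-strict
    ∣ k ∣ ℕ.* o      ≡⟨ ℤ.abs-* k (+ o) ⟨
    ∣ k * + o ∣      ≡⟨ cong ∣_∣ eq ⟨
    ∣ + m - + n ∣    ≡⟨ cong ∣_∣ (ℤ.[+m]-[+n]≡m⊖n m n) ⟩
    ∣ m ⊖ n ∣        ≤⟨ ℤ.∣m⊝n∣≤m⊔n m n ⟩
    m ℕ.⊔ n          <⟨ ℕ.⊔-lub m<o n<o ⟩
    o                ≡⟨ ℕ.*-identityˡ o ⟨
    1 ℕ.* o          ∎)))
    where open ℕ.≤-Reasoning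

  +m-+n≡k*o⇒m≡n : ∀ {m n o} k → m < o → n < o → + m - + n ≡ k * + o → m ≡ n
  +m-+n≡k*o⇒m≡n {m} {n} {o} k m<o n<o eq with refl ← +m-+n≡k*o⇒k≡0 k m<o n<o eq =
    ℤ.+-injective (ℤ.i-j≡0⇒i≡j (+ m) (+ n) eq)

  m+n≡2k+1⇒m≤k⊎n≤k : ∀ {m n k} → m ℕ.+ n ≡ 2 ℕ.* k ℕ.+ 1 → m ≤ k ⊎ n ≤ k
  m+n≡2k+1⇒m≤k⊎n≤k {m} {n} {k} eq with m ℕ.≤? k
  ... | yes m≤k = inj₁ m≤k
  ... | no  m≰k = inj₂ (ℕ.+-cancelˡ-≤ (suc k) n k (begin
    suc k ℕ.+ n        ≤⟨ ℕ.+-monoˡ-≤ n (ℕ.≰⇒> m≰k) ⟩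
    m ℕ.+ n            ≡⟨ eq ⟩
    2 ℕ.* k ℕ.+ 1      ≡⟨ twice k ⟩
    suc k ℕ.+ k        ∎))
    where
    open ℕ.≤-Reasoning
    twice : ∀ k → 2 ℕ.* k ℕ.+ 1 ≡ suc k ℕ.+ k
    twice = ℕ-Solver.solve-∀

  +m-[-+n]≡+[m+n] : ∀ m n → + m - - + n ≡ + (m ℕ.+ n)
  +m-[-+n]≡+[m+n] m n = trans (cong (λ z → + m + z) (ℤ.neg-involutive (+ n))) (sym (ℤ.pos-+ m n))

  +[m+n]-+n≡+m : ∀ m n → + (m ℕ.+ n) - + n ≡ + m
  +[m+n]-+n≡+m m n = trans (cong (_- + n) (ℤ.pos-+ m n)) (cancel (+ m) (+ n))
    where
    cancel : ∀ i j → (i + j) - j ≡ i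
    cancel = solve-∀

  record IsSubgroup (L : ℤ² → Set) : Set where
    field
      0∈         : L 0²
      +-closed   : ∀ {x y} → L x → L y → L (x +² y)
      neg-closed : ∀ {x} → L x → L (-² x)

  module Quotient {L : ℤ² → Set} (L-subgroup : IsSubgroup L) where
    open IsSubgroup L-subgroup

    infix 4 _≈_
    _≈_ : ℤ² → ℤ² → Set
    x ≈ y = L (x -² y)

    ≡⇒≈ : ∀ {x y} → x ≡ y → x ≈ y
    ≡⇒≈ {x} refl = subst L (sym (-²-inverseʳ x)) 0∈

    ≈-sym : ∀ {x y} → x ≈ y → y ≈ x
    ≈-sym {x} {y} x≈y = subst L (-²-swap x y) (neg-closed x≈y)

    ≈-trans : ∀ {x y z} → x ≈ y → y ≈ z → x ≈ z
    ≈-trans {x} {y} {z} x≈y y≈z = subst L (-²-telescope x y z) (+-closed x≈y y≈z)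

    quotientIsAbelianGroup : IsAbelianGroup _≈_ _+²_ 0² (-²_)
    quotientIsAbelianGroup = record
      { isGroup = record
        { isMonoid = record
          { isSemigroup = record
            { isMagma = record
              { isEquivalence = record { refl = λ {x} → ≡⇒≈ {x} refl
                                      ; sym = λ {x} {y} → ≈-sym {x} {y}
                                      ; trans = λ {x} {y} {z} → ≈-trans {x} {y} {z} }
              ; ∙-cong = λ {x} {y} {u} {v} x≈y u≈v → subst L (-²-interchange x y u v) (+-closed x≈y u≈v) }
            ; assoc = λ x y z → ≡⇒≈ (assoc x y z) }
          ; identity = (λ x → ≡⇒≈ (identityˡ x)) , (λ x → ≡⇒≈ (identityʳ x)) }
        ; inverse = (λ x → ≡⇒≈ (inverseˡ x)) , (λ x → ≡⇒≈ (inverseʳ x))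
        ; ⁻¹-cong = λ {x} {y} x≈y → subst L (-²-distrib x y) (neg-closed x≈y) }
      ; comm = λ x y → ≡⇒≈ (comm x y) }
      where open IsAbelianGroup ℤ²-isAbelianGroup using (assoc; identityˡ; identityʳ; inverseˡ; inverseʳ; comm)

    quotient : AbelianGroup 0ℓ 0ℓ
    quotient = record { isAbelianGroup = quotientIsAbelianGroup }

    natMul-·² : ∀ n x → natMul quotient n x ≡ + n ·² x
    natMul-·² zero    (a , b) = refl
    natMul-·² (suc n) (a , b) rewrite natMul-·² n (a , b) =
      cong₂ _,_ (sym (ℤ.suc-* (+ n) a)) (sym (ℤ.suc-* (+ n) b))

    intMul-·² : ∀ k x → intMul quotient k x ≡ k ·² x
    intMul-·² (+ n)    x       = natMul-·² n x
    intMul-·² -[1+ n ] (a , b) = trans (cong -²_ (natMul-·² (suc n) (a , b)))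
      (cong₂ _,_ (ℤ.neg-distribˡ-* (+ suc n) a) (ℤ.neg-distribˡ-* (+ suc n) b))

    intMul-e₁+intMul-e₂ : ∀ l₁ l₂ → intMul quotient l₁ e₁ +² intMul quotient l₂ e₂ ≡ (l₁ , l₂)
    intMul-e₁+intMul-e₂ l₁ l₂ rewrite intMul-·² l₁ e₁ | intMul-·² l₂ e₂ =
      cong₂ _,_ (coordinate l₁ l₂) (trans (ℤ.+-comm (l₁ * 0ℤ) (l₂ * 1ℤ)) (coordinate l₂ l₁))
      where
      coordinate : ∀ l l′ → l * 1ℤ + l′ * 0ℤ ≡ l
      coordinate = solve-∀

    module _ {P : ℤ} (∣P∣≢1 : ∣ P ∣ ≢ 1) (L⊆P : ∀ {x} → L x → P ∣² x) where

      private
        P∤1 : ¬ P ∣ 1ℤ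
        P∤1 P∣1 = ∣P∣≢1 (ℕ.∣1⇒≡1 (∣⇒∣ᵤ P∣1))

      e₁≉e₂ : ¬ e₁ ≈ e₂
      e₁≉e₂ e₁≈e₂ = P∤1 (proj₁ (L⊆P e₁≈e₂))

      -- Modulo P the generators would give 1 = det(e₁, e₂) ≡ k₁ k₂ det(g, g) = 0.
      ¬cyclic : ¬ IsCyclic quotient
      ¬cyclic (g@(g₁ , g₂) , generates) = P∤1 (subst (P ∣_) (determinant k₁ k₂ g₁ g₂)
          (∣m∣n⇒∣m-n (∣m∣n⇒∣m+n 1-k₂g₂ (∣n⇒∣m*n (g₂ * k₂) 1-k₁g₁)) (∣n⇒∣m*n (g₂ * k₁) 0-k₂g₁)))
        where
        coordinates : ∀ x → ∃ λ k → P ∣² x -² k ·² g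
        coordinates x with k , x≈kg ← generates x = k , L⊆P (subst (λ y → L (x -² y)) (intMul-·² k g) x≈kg)
        k₁ = proj₁ (coordinates e₁)
        k₂ = proj₁ (coordinates e₂)
        1-k₁g₁ : P ∣ 1ℤ - k₁ * g₁
        1-k₁g₁ = proj₁ (proj₂ (coordinates e₁))
        0-k₂g₁ : P ∣ 0ℤ - k₂ * g₁
        0-k₂g₁ = proj₁ (proj₂ (coordinates e₂))
        1-k₂g₂ : P ∣ 1ℤ - k₂ * g₂
        1-k₂g₂ = proj₂ (proj₂ (coordinates e₂))
        determinant : ∀ k₁ k₂ g₁ g₂ →
          (1ℤ - k₂ * g₂) + (g₂ * k₂) * (1ℤ - k₁ * g₁) - (g₂ * k₁) * (0ℤ - k₂ * g₁) ≡ 1ℤ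
        determinant = solve-∀

  Span : ℤ² → ℤ² → ℤ² → Set
  Span u v x = ∃₂ λ i j → x ≡ i ·² u +² j ·² v

  span-isSubgroup : ∀ u v → IsSubgroup (Span u v)
  span-isSubgroup (a , b) (c , d) = record
    { 0∈ = 0ℤ , 0ℤ , refl
    ; +-closed = λ { (i , j , refl) (i′ , j′ , refl) →
        i + i′ , j + j′ , cong₂ _,_ (+-combination i j i′ j′ a c) (+-combination i j i′ j′ b d) }
    ; neg-closed = λ { (i , j , refl) → - i , - j , cong₂ _,_ (neg-combination i j a c) (neg-combination i j b d) } }
    where
    +-combination : ∀ i j i′ j′ a c → (i * a + j * c) + (i′ * a + j′ * c) ≡ (i + i′) * a + (j + j′) * c
    +-combination = solve-∀
    neg-combination : ∀ i j a c → - (i * a + j * c) ≡ (- i) * a + (- j) * c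
    neg-combination = solve-∀

  u∈span : ∀ u v → Span u v u
  u∈span (a , b) (c , d) = 1ℤ , 0ℤ , cong₂ _,_ (unit a c) (unit b d)
    where
    unit : ∀ a c → a ≡ 1ℤ * a + 0ℤ * c
    unit = solve-∀

  u+v∈span : ∀ u v → Span u v (u +² v)
  u+v∈span (a , b) (c , d) = 1ℤ , 1ℤ , cong₂ _,_ (sum a c) (sum b d)
    where
    sum : ∀ a c → a + c ≡ 1ℤ * a + 1ℤ * c
    sum = solve-∀

  span-∣² : ∀ {P u v x} → P ∣² u → P ∣² v → Span u v x → P ∣² x
  span-∣² (P∣a , P∣b) (P∣c , P∣d) (i , j , refl) =
    ∣m∣n⇒∣m+n (∣n⇒∣m*n i P∣a) (∣n⇒∣m*n j P∣c) , ∣m∣n⇒∣m+n (∣n⇒∣m*n i P∣b) (∣n⇒∣m*n j P∣d)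

  module Lattice (A B : ℕ) .{{_ : NonZero A}} .{{_ : NonZero B}} where

    u v : ℤ²
    u = + A , + B
    v = + A , - + B

    L : ℤ² → Set
    L = Span u v

    open Quotient (span-isSubgroup u v) public

    private instance
      A+A-nonZero : NonZero (A ℕ.+ A)
      A+A-nonZero = ℕ.≢-nonZero (λ A+A≡0 → ℕ.≢-nonZero⁻¹ A (ℕ.m+n≡0⇒m≡0 A A+A≡0))

    box : Fin (A ℕ.+ A) × Fin B → ℤ²
    box (i , j) = + toℕ i , + toℕ j

    box-surjective : ∀ x → ∃ λ c → box c ≈ x
    box-surjective (a , b) = c , ≈-sym {a , b} (subst ((a , b) ≈_) (sym box-c) x≈x₀y₀)
      where
      q = b /ℕ B
      a′ = a - q * + A
      q′ = a′ /ℕ (A ℕ.+ A)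
      x₀ = a′ %ℕ (A ℕ.+ A)
      y₀ = b %ℕ B
      c = fromℕ< (n%ℕd<d a′ (A ℕ.+ A)) , fromℕ< (n%ℕd<d b B)
      box-c : box c ≡ (+ x₀ , + y₀)
      box-c = cong₂ _,_ (cong +_ (Fin.toℕ-fromℕ< _)) (cong +_ (Fin.toℕ-fromℕ< _))
      split : ∀ a x q A → a - x ≡ ((a - q * A) - x) + q * A
      split = solve-∀
      first-combination : ∀ x q q′ A → ((x + q′ * (A + A)) - x) + q * A ≡ (q + q′) * A + q′ * A
      first-combination = solve-∀
      second-combination : ∀ y q q′ B → (y + q * B) - y ≡ (q + q′) * B + q′ * (- B)
      second-combination = solve-∀
      first : a - + x₀ ≡ (q + q′) * + A + q′ * + A
      first = begin
        a - + x₀                                    ≡⟨ split a (+ x₀) q (+ A) ⟩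
        (a′ - + x₀) + q * + A                       ≡⟨ cong (λ z → (z - + x₀) + q * + A) (a≡a%ℕn+[a/ℕn]*n a′ (A ℕ.+ A)) ⟩
        ((+ x₀ + q′ * + (A ℕ.+ A)) - + x₀) + q * + A ≡⟨ cong (λ z → ((+ x₀ + q′ * z) - + x₀) + q * + A) (ℤ.pos-+ A A) ⟩
        ((+ x₀ + q′ * (+ A + + A)) - + x₀) + q * + A ≡⟨ first-combination (+ x₀) q q′ (+ A) ⟩
        (q + q′) * + A + q′ * + A                   ∎
        where open ≡-Reasoning
      second : b - + y₀ ≡ (q + q′) * + B + q′ * - + B
      second = trans (cong (_- + y₀) (a≡a%ℕn+[a/ℕn]*n b B)) (second-combination (+ y₀) q q′ (+ B))
      x≈x₀y₀ : (a , b) ≈ (+ x₀ , + y₀)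
      x≈x₀y₀ = q + q′ , q′ , cong₂ _,_ first second

    box-injective : ∀ c d → box c ≈ box d → c ≡ d
    box-injective (i , j) (i′ , j′) (k , l , eq) =
      cong₂ _,_ (Fin.toℕ-injective i≡i′) (Fin.toℕ-injective j≡j′)
      where
      difference : ∀ k l B → k * B + l * (- B) ≡ (k - l) * B
      difference = solve-∀
      doubling : ∀ k A → k * A + k * A ≡ k * (A + A)
      doubling = solve-∀
      y-eq : + toℕ j - + toℕ j′ ≡ (k - l) * + B
      y-eq = trans (cong proj₂ eq) (difference k l (+ B))
      j≡j′ : toℕ j ≡ toℕ j′
      j≡j′ = +m-+n≡k*o⇒m≡n (k - l) (Fin.toℕ<n j) (Fin.toℕ<n j′) y-eq
      k≡l : k ≡ l
      k≡l = ℤ.i-j≡0⇒i≡j k l (+m-+n≡k*o⇒k≡0 (k - l) (Fin.toℕ<n j) (Fin.toℕ<n j′) y-eq)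
      x-eq : + toℕ i - + toℕ i′ ≡ k * + (A ℕ.+ A)
      x-eq = begin
        + toℕ i - + toℕ i′    ≡⟨ cong proj₁ eq ⟩
        k * + A + l * + A     ≡⟨ cong (λ z → k * + A + z * + A) k≡l ⟨
        k * + A + k * + A     ≡⟨ doubling k (+ A) ⟩
        k * (+ A + + A)       ≡⟨ cong (k *_) (ℤ.pos-+ A A) ⟨
        k * + (A ℕ.+ A)       ∎
        where open ≡-Reasoning
      i≡i′ : toℕ i ≡ toℕ i′
      i≡i′ = +m-+n≡k*o⇒m≡n k (Fin.toℕ<n i) (Fin.toℕ<n i′) x-eq

    hasOrder : HasOrder quotient ((A ℕ.+ A) ℕ.* B)
    hasOrder = hasOrder-× quotient box box-surjective box-injective

    module _ {S : ℕ} (A+B≡2S+1 : A ℕ.+ B ≡ 2 ℕ.* S ℕ.+ 1) where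

      HasShortRepresentative : ℤ² → Set
      HasShortRepresentative x = ∃₂ λ l₁ l₂ → ∣ l₁ ∣ ℕ.+ ∣ l₂ ∣ ≤ S × x ≈ (l₁ , l₂)

      short-left : ∀ {x₀ y₀ a b} → x₀ ℕ.+ a ≡ A → y₀ ℕ.+ b ≡ B → HasShortRepresentative (+ x₀ , + y₀)
      short-left {x₀} {y₀} {a} {b} x₀+a≡A y₀+b≡B
        with m+n≡2k+1⇒m≤k⊎n≤k (trans (+-interchange x₀ y₀ a b) (trans (cong₂ ℕ._+_ x₀+a≡A y₀+b≡B) A+B≡2S+1))
      ... | inj₁ ≤S = + x₀ , + y₀ , ≤S , ≡⇒≈ {+ x₀ , + y₀} refl
      ... | inj₂ ≤S = - + a , - + b ,
        subst (_≤ S) (sym (cong₂ ℕ._+_ (ℤ.∣-i∣≡∣i∣ (+ a)) (ℤ.∣-i∣≡∣i∣ (+ b)))) ≤S ,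
        subst L (sym (cong₂ _,_ (trans (+m-[-+n]≡+[m+n] x₀ a) (cong +_ x₀+a≡A))
                                (trans (+m-[-+n]≡+[m+n] y₀ b) (cong +_ y₀+b≡B))))
          (u∈span u v)

      short-right : ∀ {x₀ y₀ a b c} → A ℕ.+ a ≡ x₀ → x₀ ℕ.+ c ≡ A ℕ.+ A → y₀ ℕ.+ b ≡ B →
                    HasShortRepresentative (+ x₀ , + y₀)
      short-right {x₀} {y₀} {a} {b} {c} A+a≡x₀ x₀+c≡2A y₀+b≡B
        with m+n≡2k+1⇒m≤k⊎n≤k (trans (+-interchange c y₀ a b) (trans (cong₂ ℕ._+_ c+a≡A y₀+b≡B) A+B≡2S+1))
        where
        c+a≡A : c ℕ.+ a ≡ A
        c+a≡A = ℕ.+-cancelˡ-≡ A (c ℕ.+ a) A (begin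
          A ℕ.+ (c ℕ.+ a)   ≡⟨ cong (A ℕ.+_) (ℕ.+-comm c a) ⟩
          A ℕ.+ (a ℕ.+ c)   ≡⟨ ℕ.+-assoc A a c ⟨
          A ℕ.+ a ℕ.+ c     ≡⟨ cong (ℕ._+ c) A+a≡x₀ ⟩
          x₀ ℕ.+ c          ≡⟨ x₀+c≡2A ⟩
          A ℕ.+ A           ∎)
          where open ≡-Reasoning
      ... | inj₁ ≤S = - + c , + y₀ , subst (_≤ S) (sym (cong (ℕ._+ y₀) (ℤ.∣-i∣≡∣i∣ (+ c)))) ≤S ,
        subst L (sym (cong₂ _,_ (trans (+m-[-+n]≡+[m+n] x₀ c) (trans (cong +_ x₀+c≡2A) (ℤ.pos-+ A A)))
                                (trans (ℤ.+-inverseʳ (+ y₀)) (sym (ℤ.+-inverseʳ (+ B))))))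
          (u+v∈span u v)
      ... | inj₂ ≤S = + a , - + b , subst (_≤ S) (sym (cong (a ℕ.+_) (ℤ.∣-i∣≡∣i∣ (+ b)))) ≤S ,
        subst L (sym (cong₂ _,_ (trans (cong (λ z → + z - + a) (sym A+a≡x₀)) (+[m+n]-+n≡+m A a))
                                (trans (+m-[-+n]≡+[m+n] y₀ b) (cong +_ y₀+b≡B))))
          (u∈span u v)

      box-short : ∀ c → HasShortRepresentative (box c)
      box-short (i , j) with toℕ i ℕ.<? A | ℕ.m+[n∸m]≡n (ℕ.<⇒≤ (Fin.toℕ<n j))
      ... | yes x₀<A | y₀+b≡B = short-left (ℕ.m+[n∸m]≡n (ℕ.<⇒≤ x₀<A)) y₀+b≡B
      ... | no  x₀≮A | y₀+b≡B =
        short-right (ℕ.m+[n∸m]≡n (ℕ.≮⇒≥ x₀≮A)) (ℕ.m+[n∸m]≡n (ℕ.<⇒≤ (Fin.toℕ<n i))) y₀+b≡B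

      e₁,e₂-span : ∀ x → ∃₂ λ l₁ l₂ → ∣ l₁ ∣ ℕ.+ ∣ l₂ ∣ ≤ S × x ≈ intMul quotient l₁ e₁ +² intMul quotient l₂ e₂
      e₁,e₂-span x with box-surjective x
      ... | c , c≈x with box-short c
      ...   | l₁ , l₂ , ≤S , c≈l =
        l₁ , l₂ , ≤S , ≈-trans {x} {l₁ , l₂} (≈-trans {x} {box c} (≈-sym {box c} {x} c≈x) c≈l)
                                      (≡⇒≈ (sym (intMul-e₁+intMul-e₂ l₁ l₂)))

  noncyclic-with-spanning-pair : ∀ P r S .{{_ : NonTrivial P}} .{{_ : NonZero r}} →
    P ℕ.* suc r ℕ.+ P ℕ.* r ≡ 2 ℕ.* S ℕ.+ 1 →
    Σ (AbelianGroup 0ℓ 0ℓ) λ G →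
      HasOrder G ((P ℕ.* suc r ℕ.+ P ℕ.* suc r) ℕ.* (P ℕ.* r)) × ¬ IsCyclic G × HasSpanningSetOfSize2 G S
  noncyclic-with-spanning-pair P r S A+B≡2S+1 =
    quotient , hasOrder , ¬cyclic P≢1 L⊆Pℤ² , e₁ , e₂ , e₁≉e₂ P≢1 L⊆Pℤ² , e₁,e₂-span A+B≡2S+1
    where
    instance
      A-nonZero : NonZero (P ℕ.* suc r)
      A-nonZero = ℕ.m*n≢0 P (suc r) {{ℕ.nonTrivial⇒nonZero P}}
      B-nonZero : NonZero (P ℕ.* r)
      B-nonZero = ℕ.m*n≢0 P r {{ℕ.nonTrivial⇒nonZero P}}
    open Lattice (P ℕ.* suc r) (P ℕ.* r)
    P≢1 : ∣ + P ∣ ≢ 1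
    P≢1 = ℕ.nonTrivial⇒≢1
    P∣P* : ∀ n → + P ∣ + (P ℕ.* n)
    P∣P* n = ∣ᵤ⇒∣ (ℕ.m∣m*n n)
    L⊆Pℤ² : ∀ {x} → L x → + P ∣² x
    L⊆Pℤ² = span-∣² (P∣P* (suc r) , P∣P* r) (P∣P* (suc r) , ∣m⇒∣-m (P∣P* r))

open Lattices using (noncyclic-with-spanning-pair)
open import Data.Nat using (ℕ; zero; suc; _+_; _*_; _∸_; _/_; _≤_)
open import Data.Nat.Divisibility using (_∣_; divides)
open import Data.Nat.Primality using (Prime; prime; Composite)

even-or-odd : ∀ n → ∃ λ t → n ≡ 2 * t ⊎ n ≡ 2 * t + 1
even-or-odd zero = 0 , inj₁ refl
even-or-odd (suc n) with even-or-odd n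
... | t , inj₁ refl = t , inj₂ (ℕ.+-comm 1 (2 * t))
... | t , inj₂ refl = suc t , inj₁ (double-suc t)
  where
  double-suc : ∀ t → suc (2 * t + 1) ≡ 2 * suc t
  double-suc = ℕ-Solver.solve-∀

odd-factor : ∀ m n k → 2 * k + 1 ≡ m * n → ∃ λ t → n ≡ 2 * t + 1
odd-factor m n k 2k+1≡mn with even-or-odd n
... | t , inj₂ n≡2t+1 = t , n≡2t+1
... | t , inj₁ refl = ⊥-elim (ℕ.even≢odd (m * t) k (begin
  2 * (m * t)    ≡⟨ swap m t ⟩
  m * (2 * t)    ≡⟨ 2k+1≡mn ⟨
  2 * k + 1      ≡⟨ ℕ.+-comm (2 * k) 1 ⟩
  suc (2 * k)    ∎))
  where
  open ≡-Reasoning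
  swap : ∀ m t → 2 * (m * t) ≡ m * (2 * t)
  swap = ℕ-Solver.solve-∀

half-odd-product : ∀ s t r → 2 * s + 1 ≡ (2 * r + 1) * (2 * t + 1) → s ≡ (2 * t + 1) * r + t
half-odd-product s t r 2s+1≡qp =
  ℕ.*-cancelˡ-≡ s _ 2 (ℕ.+-cancelʳ-≡ 1 (2 * s) _ (trans 2s+1≡qp (odd-product t r)))
  where
  odd-product : ∀ t r → (2 * r + 1) * (2 * t + 1) ≡ 2 * ((2 * t + 1) * r + t) + 1
  odd-product = ℕ-Solver.solve-∀

-- (p² − 1)/2 = 2t(t + 1) =: T, and 2s² + 2s exceeds T by exactly 2AB.
order-formula : ∀ t r → let p = 2 * t + 1 ; s = p * r + t in
  (p * suc r + p * suc r) * (p * r) ≡ (2 * s * s + 2 * s) ∸ ((p * p ∸ 1) / 2)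
order-formula t r = begin
  2AB                                   ≡⟨ ℕ.m+n∸n≡m 2AB T ⟨
  2AB + T ∸ T                           ≡⟨ cong₂ _∸_ (square-sum t r) (ℕ.m*n/n≡m T 2) ⟨
  (2 * s * s + 2 * s) ∸ (T * 2 / 2)     ≡⟨ cong (λ n → (2 * s * s + 2 * s) ∸ n / 2) (p²-1 t) ⟨
  (2 * s * s + 2 * s) ∸ ((p * p ∸ 1) / 2) ∎
  where
  open ≡-Reasoning
  p = 2 * t + 1
  s = p * r + t
  2AB = (p * suc r + p * suc r) * (p * r)
  T = 2 * t * suc t
  square-sum : ∀ t r → 2 * ((2 * t + 1) * r + t) * ((2 * t + 1) * r + t) + 2 * ((2 * t + 1) * r + t)
    ≡ ((2 * t + 1) * suc r + (2 * t + 1) * suc r) * ((2 * t + 1) * r) + 2 * t * suc t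
  square-sum = ℕ-Solver.solve-∀
  p²-1 : ∀ t → (2 * t + 1) * (2 * t + 1) ∸ 1 ≡ 2 * t * suc t * 2
  p²-1 t = trans (cong (_∸ 1) (square t)) (ℕ.m+n∸n≡m _ 1)
    where
    square : ∀ t → (2 * t + 1) * (2 * t + 1) ≡ 2 * t * suc t * 2 + 1
    square = ℕ-Solver.solve-∀

mainTheorem7 : (s p : ℕ) → 1 ≤ s → Composite (2 * s + 1) → Prime p → p ∣ 2 * s + 1 →
    Σ (AbelianGroup 0ℓ 0ℓ) λ G →
      HasOrder G ((2 * s * s + 2 * s) ∸ ((p * p ∸ 1) / 2)) × ¬ IsCyclic G × HasSpanningSetOfSize2 G s
mainTheorem7 s p _ 2s+1-composite (prime {{p-nontrivial}} p-notComposite) (divides q 2s+1≡qp)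
  with t , refl ← odd-factor q p s 2s+1≡qp
  with r , refl ← odd-factor p q s (trans 2s+1≡qp (ℕ.*-comm q p))
  with refl ← half-odd-product s t r 2s+1≡qp =
  map₂ (λ {G} → map₁ (subst (HasOrder G) (order-formula t r)))
    (noncyclic-with-spanning-pair p r s {{p-nontrivial}} {{ℕ.≢-nonZero r≢0}} (trans (odd-multiple p r) (sym 2s+1≡qp)))
  where
  r≢0 : r ≢ 0
  r≢0 refl = p-notComposite (subst Composite (trans 2s+1≡qp (ℕ.+-identityʳ p)) 2s+1-composite)
  odd-multiple : ∀ p r → p * suc r + p * r ≡ (2 * r + 1) * p
  odd-multiple = ℕ-Solver.solve-∀
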